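{- Let $G$ be a finite simple graph, $A_1,A_2$ disjoint subsets of $V(G)$, and $G^*$ the graph obtained by toggling all pairs between $A_1$ and $A_2$, with closed neighborhood matrices $N$ and $N^*$. Suppose $A_1$ and $A_2$ are NO sets in $G$ and $A_2$ is $\overline{\mathbf{x}_{A_1}}$-AO in $G$. Then for every pattern $\mathbf{p}$, $N^*\mathbf{p}=\mathbf{1}$ if and only if $N\mathbf{p}\in\{\mathbf{1},\ \overline{\mathbf{x}_{A_1}},\ \overline{\mathbf{x}_{A_2}},\ \overline{\mathbf{x}_{A_1\cup A_2}}\}$. Moreover, $A_1$ and $A_2$ are HO in $G^*$ and $\nu(G^*)=\nu(G)+2$.
   Context: For a graph $H$ with vertex set $V=\{v_1,\dots,v_n\}$, $N(H)$ is the closed neighborhood matrix over $\mathbb{Z}_2$ (entry $(i,j)$ is $1$ iff $i=j$ or $v_iv_j$ is an edge), $\nu(H)=\dim\ker N(H)$. Given disjoint $A_1,A_2\subseteq V(G)$, $G^*$ is obtained from $G$ by, for every $u\in A_1$, $v\in A_2$, adding the edge $uv$ if $u,v$ are non-adjacent and removing it if they are adjacent; $N=N(G)$, $N^*=N(G^*)$. Subsets $A$ are identified with characteristic vectors $\mathbf{x}_A$; $\mathbf{x}\cdot\mathbf{y}=\mathbf{x}^t\mathbf{y}$ over $\mathbb{Z}_2$; $\mathbf{1}$ is the all-ones vector, $\overline{\mathbf{x}}:=\mathbf{x}+\mathbf{1}$. In a graph $H$ with matrix $M$: a pattern $\mathbf{p}$ solves configuration $\mathbf{c}$ if $M\mathbf{p}=\mathbf{c}$;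 $\mathbf{c}$ (or a set $A$ via $\mathbf{x}_A$) is solvable if some pattern solves it; $\mathbf{1}$ is always solvable. A set $A$ is HO if it is not solvable. For solvable $A$ and solvable $\mathbf{c}$, $A$ is $\mathbf{c}$-AO if $\mathbf{x}_A\cdot\mathbf{p}=1$ for all solving patterns $\mathbf{p}$ of $\mathbf{c}$, and $\mathbf{c}$-NO if $\mathbf{x}_A\cdot\mathbf{p}=0$ for all of them; AO and NO mean $\mathbf{1}$-AO and $\mathbf{1}$-NO. -}

module Defs where

open import Data.Nat using (ℕ; zero; suc)
open import Data.Fin using (Fin; zero; suc; _≟_)
open import Data.Bool using (Bool; true; false; _∧_; _∨_; _xor_; not)
open import Data.Product using (Σ; _×_; ∃)
open import Relation.Nullary using (¬_)
open import Relation.Nullary.Decidable using (⌊_⌋)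
open import Relation.Binary.PropositionalEquality using (_≡_)

-- Vectors over Z₂ = Bool (xor is addition, ∧ is multiplication),
-- represented as functions Fin n → Bool.  Subsets of V = Fin n are
-- identified with their characteristic vectors.
Vec₂ : ℕ → Set
Vec₂ n = Fin n → Bool

Mat₂ : ℕ → Set
Mat₂ n = Fin n → Fin n → Bool

_≐_ : {n : ℕ} → Vec₂ n → Vec₂ n → Set
x ≐ y = ∀ i → x i ≡ y i

Σ₂ : {n : ℕ} → (Fin n → Bool) → Bool
Σ₂ {zero}  f = false
Σ₂ {suc n} f = f zero xor Σ₂ {n} (λ i → f (suc i))

_·ᵥ_ : {n : ℕ} → Mat₂ n → Vec₂ n → Vec₂ n
(M ·ᵥ p) i = Σ₂ (λ j → M i j ∧ p j)

_•_ : {n : ℕ} → Vec₂ n → Vec₂ n → Bool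
x • y = Σ₂ (λ i → x i ∧ y i)

𝟏 : {n : ℕ} → Vec₂ n
𝟏 _ = true

‾ : {n : ℕ} → Vec₂ n → Vec₂ n
‾ x i = not (x i)

_∪_ : {n : ℕ} → Vec₂ n → Vec₂ n → Vec₂ n
(A ∪ B) i = A i ∨ B i

Disjoint : {n : ℕ} → Vec₂ n → Vec₂ n → Set
Disjoint A B = ∀ i → A i ∧ B i ≡ false

record SimpleGraph (n : ℕ) : Set where
  field
    adj    : Fin n → Fin n → Bool
    sym    : ∀ i j → adj i j ≡ adj j i
    irrefl : ∀ i → adj i i ≡ false

open SimpleGraph public

closedNbhd : {n : ℕ} → (Fin n → Fin n → Bool) → Mat₂ n
closedNbhd a i j = ⌊ i ≟ j ⌋ ∨ a i j

N : {n : ℕ} → SimpleGraph n → Mat₂ n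
N G = closedNbhd (adj G)

toggleAdj : {n : ℕ} → SimpleGraph n → Vec₂ n → Vec₂ n → Fin n → Fin n → Bool
toggleAdj G A₁ A₂ i j = adj G i j xor ((A₁ i ∧ A₂ j) ∨ (A₁ j ∧ A₂ i))

N* : {n : ℕ} → SimpleGraph n → Vec₂ n → Vec₂ n → Mat₂ n
N* G A₁ A₂ = closedNbhd (toggleAdj G A₁ A₂)

Solves : {n : ℕ} → Mat₂ n → Vec₂ n → Vec₂ n → Set
Solves M p c = (M ·ᵥ p) ≐ c

Solvable : {n : ℕ} → Mat₂ n → Vec₂ n → Set
Solvable M c = ∃ λ p → Solves M p c

HO : {n : ℕ} → Mat₂ n → Vec₂ n → Set
HO M A = ¬ Solvable M A

AO[_] : {n : ℕ} → Vec₂ n → Mat₂ n → Vec₂ n → Set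
AO[ c ] M A = Solvable M A × Solvable M c × (∀ p → Solves M p c → A • p ≡ true)

NO[_] : {n : ℕ} → Vec₂ n → Mat₂ n → Vec₂ n → Set
NO[ c ] M A = Solvable M A × Solvable M c × (∀ p → Solves M p c → A • p ≡ false)

AO NO : {n : ℕ} → Mat₂ n → Vec₂ n → Set
AO = AO[ 𝟏 ]
NO = NO[ 𝟏 ]

lincomb : {n k : ℕ} → (Fin k → Vec₂ n) → (Fin k → Bool) → Vec₂ n
lincomb {k = k} b c x = Σ₂ {k} (λ i → c i ∧ b i x)

IsKernelBasis : {n k : ℕ} → Mat₂ n → (Fin k → Vec₂ n) → Set
IsKernelBasis {n} {k} M b =
  (∀ i → (M ·ᵥ b i) ≐ (λ _ → false))
  × (∀ (c : Fin k → Bool) → lincomb b c ≐ (λ _ → false) → c ≐ (λ _ → false))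
  × (∀ (v : Vec₂ n) → (M ·ᵥ v) ≐ (λ _ → false) → ∃ λ (c : Fin k → Bool) → v ≐ lincomb b c)

HasNullity : {n : ℕ} → Mat₂ n → ℕ → Set
HasNullity {n} M k = Σ (Fin k → Vec₂ n) (IsKernelBasis M)

-- Over Z₂ the toggle is the rank-two update N* = N + A₁A₂ᵗ + A₂A₁ᵗ. If r₁, r₂ solve A₁, A₂,
-- symmetry of N gives A₂ • p = r₂ • N p and A₁ • p = r₁ • N p, so N* p = project (N p) with
-- project c = c + (r₂ • c) A₁ + (r₁ • c) A₂. The NO and AO hypotheses imply that (r₂, r₁) is
-- the dual basis of (A₁, A₂) and that both annihilate 𝟏. Hence project is the projection along
-- span {A₁, A₂} onto the common kernel of r₂ •_ and r₁ •_, and everything follows: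
-- N* p = 𝟏 iff N p ∈ 𝟏 + span {A₁, A₂}; A₁ and A₂ are outside the image of project; and
-- ker N* = ker N ⊕ span {r₁, r₂}.

module Submission where

open import Defs hiding (sym)
open import Data.Nat using (ℕ; zero; suc; _+_)
open import Data.Fin using (Fin; zero; suc; _≟_; _↑ˡ_; _↑ʳ_; splitAt)
open import Data.Vec.Functional using (_++_; _∷_; [])
open import Data.Vec.Functional.Properties using (lookup-++ˡ; lookup-++ʳ)
open import Data.Bool using (Bool; true; false; _∧_; _∨_; _xor_; not)
open import Data.Bool.Properties
  using (∧-comm; ∧-assoc; ∧-idem; ∧-zeroʳ; ∧-identityʳ; ∧-distribˡ-xor; ∧-distribʳ-xor;
         xor-assoc; xor-comm; xor-same; xor-identityʳ)
open import Data.Sum using (_⊎_; inj₁; inj₂; [_,_]; [_,_]′)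
open import Data.Product using (_×_; _,_; proj₁; proj₂; ∃)
open import Function using (_∘_)
open import Function.Bundles using (_⇔_; mk⇔)
open import Function.Construct.Composition using (_⇔-∘_)
open import Relation.Nullary.Decidable using (⌊_⌋; yes; no; ⌊⌋-map′; isYes≗does; dec-true)
open import Relation.Binary.PropositionalEquality
  using (_≡_; refl; sym; trans; cong; cong₂; _→-setoid_; module ≡-Reasoning)
import Relation.Binary.Reasoning.Setoid as SetoidReasoning

module ≐-Reasoning {n : ℕ} = SetoidReasoning (Fin n →-setoid Bool)

private
  variable
    m n : ℕ

xor-cancelʳ : ∀ a b → (a xor b) xor b ≡ a
xor-cancelʳ a b = begin
  (a xor b) xor b   ≡⟨ xor-assoc a b b ⟩
  a xor (b xor b)   ≡⟨ cong (a xor_) (xor-same b) ⟩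
  a xor false       ≡⟨ xor-identityʳ a ⟩
  a                 ∎
  where open ≡-Reasoning

xor-cancel-middle : ∀ a b c → (a xor b) xor (b xor c) ≡ a xor c
xor-cancel-middle a b c = begin
  (a xor b) xor (b xor c)   ≡⟨ xor-assoc a b (b xor c) ⟩
  a xor (b xor (b xor c))   ≡⟨ cong (a xor_) (xor-assoc b b c) ⟨
  a xor ((b xor b) xor c)   ≡⟨ cong (λ x → a xor (x xor c)) (xor-same b) ⟩
  a xor c                   ∎
  where open ≡-Reasoning

xor-interchange : ∀ a b c d → (a xor b) xor (c xor d) ≡ (a xor c) xor (b xor d)
xor-interchange a b c d = begin
  (a xor b) xor (c xor d)   ≡⟨ xor-assoc a b (c xor d) ⟩
  a xor (b xor (c xor d))   ≡⟨ cong (a xor_) (xor-assoc b c d) ⟨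
  a xor ((b xor c) xor d)   ≡⟨ cong (λ x → a xor (x xor d)) (xor-comm b c) ⟩
  a xor ((c xor b) xor d)   ≡⟨ cong (a xor_) (xor-assoc c b d) ⟩
  a xor (c xor (b xor d))   ≡⟨ xor-assoc a c (b xor d) ⟨
  (a xor c) xor (b xor d)   ∎
  where open ≡-Reasoning

∨≡xor : ∀ a b → a ∧ b ≡ false → a ∨ b ≡ a xor b
∨≡xor true  true  ()
∨≡xor true  false _ = refl
∨≡xor false b     _ = refl

∧-∧-zero : ∀ a b c d → a ∧ b ≡ false → (a ∧ c) ∧ (b ∧ d) ≡ false
∧-∧-zero true  true  c d ()
∧-∧-zero true  false c d _ = ∧-zeroʳ c
∧-∧-zero false b     c d _ = refl

∧-left-comm : ∀ a b c → a ∧ (b ∧ c) ≡ b ∧ (a ∧ c)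
∧-left-comm a b c = begin
  a ∧ (b ∧ c)   ≡⟨ ∧-assoc a b c ⟨
  (a ∧ b) ∧ c   ≡⟨ cong (_∧ c) (∧-comm a b) ⟩
  (b ∧ a) ∧ c   ≡⟨ ∧-assoc b a c ⟩
  b ∧ (a ∧ c)   ∎
  where open ≡-Reasoning

≟-sym : (i j : Fin n) → ⌊ i ≟ j ⌋ ≡ ⌊ j ≟ i ⌋
≟-sym zero    zero    = refl
≟-sym zero    (suc j) = refl
≟-sym (suc i) zero    = refl
≟-sym (suc i) (suc j) =
  trans (⌊⌋-map′ _ _ (i ≟ j)) (trans (≟-sym i j) (sym (⌊⌋-map′ _ _ (j ≟ i))))

≟-refl : (i : Fin n) → ⌊ i ≟ i ⌋ ≡ true
≟-refl i = trans (isYes≗does (i ≟ i)) (dec-true (i ≟ i) refl)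

-- Sums over Z₂

Σ₂-cong : {f g : Fin n → Bool} → (∀ i → f i ≡ g i) → Σ₂ f ≡ Σ₂ g
Σ₂-cong {zero}  h = refl
Σ₂-cong {suc n} h = cong₂ _xor_ (h zero) (Σ₂-cong (h ∘ suc))

Σ₂-zero : Σ₂ {n} (λ _ → false) ≡ false
Σ₂-zero {zero}  = refl
Σ₂-zero {suc n} = Σ₂-zero {n}

Σ₂-xor : (f g : Fin n → Bool) → Σ₂ (λ i → f i xor g i) ≡ Σ₂ f xor Σ₂ g
Σ₂-xor {zero}  f g = refl
Σ₂-xor {suc n} f g =
  trans (cong ((f zero xor g zero) xor_) (Σ₂-xor (f ∘ suc) (g ∘ suc)))
        (xor-interchange (f zero) (g zero) (Σ₂ (f ∘ suc)) (Σ₂ (g ∘ suc)))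

∧-distribˡ-Σ₂ : ∀ a (f : Fin n → Bool) → a ∧ Σ₂ f ≡ Σ₂ (λ i → a ∧ f i)
∧-distribˡ-Σ₂ {zero}  a f = ∧-zeroʳ a
∧-distribˡ-Σ₂ {suc n} a f =
  trans (∧-distribˡ-xor a (f zero) (Σ₂ (f ∘ suc)))
        (cong ((a ∧ f zero) xor_) (∧-distribˡ-Σ₂ a (f ∘ suc)))

Σ₂-comm : (f : Fin n → Fin m → Bool) →
          Σ₂ (λ i → Σ₂ (λ j → f i j)) ≡ Σ₂ (λ j → Σ₂ (λ i → f i j))
Σ₂-comm {zero}  {m} f = sym (Σ₂-zero {m})
Σ₂-comm {suc n} {m} f =
  trans (cong (Σ₂ (f zero) xor_) (Σ₂-comm (f ∘ suc)))
        (sym (Σ₂-xor (f zero) (λ j → Σ₂ (λ i → f (suc i) j))))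

-- Over Z₂ the off-diagonal terms of a symmetric double sum cancel in pairs.
Σ₂-diagonal : (f : Fin n → Fin n → Bool) → (∀ i j → f i j ≡ f j i) →
              Σ₂ (λ i → Σ₂ (λ j → f i j)) ≡ Σ₂ (λ i → f i i)
Σ₂-diagonal {zero}  f f-sym = refl
Σ₂-diagonal {suc n} f f-sym = begin
  (f zero zero xor Σ₂ (λ j → f zero (suc j)))
    xor Σ₂ (λ i → f (suc i) zero xor Σ₂ (λ j → f (suc i) (suc j)))
    ≡⟨ cong ((f zero zero xor Σ₂ (λ j → f zero (suc j))) xor_)
         (Σ₂-xor (λ i → f (suc i) zero) (λ i → Σ₂ (λ j → f (suc i) (suc j)))) ⟩
  (f zero zero xor Σ₂ (λ j → f zero (suc j)))
    xor (Σ₂ (λ i → f (suc i) zero) xor Σ₂ (λ i → Σ₂ (λ j → f (suc i) (suc j))))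
    ≡⟨ cong₂ (λ x y → (f zero zero xor x) xor (Σ₂ (λ i → f (suc i) zero) xor y))
             (Σ₂-cong (λ j → f-sym zero (suc j)))
             (Σ₂-diagonal (λ i j → f (suc i) (suc j)) (λ i j → f-sym (suc i) (suc j))) ⟩
  (f zero zero xor Σ₂ (λ i → f (suc i) zero))
    xor (Σ₂ (λ i → f (suc i) zero) xor Σ₂ (λ i → f (suc i) (suc i)))
    ≡⟨ xor-cancel-middle (f zero zero) _ _ ⟩
  f zero zero xor Σ₂ (λ i → f (suc i) (suc i))
    ∎
  where open ≡-Reasoning

Σ₂-split : ∀ m (f : Fin (m + n) → Bool) →
       Σ₂ f ≡ Σ₂ (λ i → f (i ↑ˡ n)) xor Σ₂ (λ j → f (m ↑ʳ j))
Σ₂-split zero    f = refl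
Σ₂-split (suc m) f =
  trans (cong (f zero xor_) (Σ₂-split m (f ∘ suc))) (sym (xor-assoc (f zero) _ _))

Σ₂-δ : (i : Fin n) (f : Fin n → Bool) → Σ₂ (λ j → ⌊ i ≟ j ⌋ ∧ f j) ≡ f i
Σ₂-δ {suc n} zero f =
  trans (cong (f zero xor_) (Σ₂-zero {n})) (xor-identityʳ (f zero))
Σ₂-δ {suc n} (suc i) f =
  trans (Σ₂-cong (λ j → cong (_∧ f (suc j)) (⌊⌋-map′ _ _ (i ≟ j)))) (Σ₂-δ i (f ∘ suc))

Σ₂-δ′ : (i : Fin n) (f : Fin n → Bool) → Σ₂ (λ j → ⌊ j ≟ i ⌋ ∧ f j) ≡ f i
Σ₂-δ′ i f = trans (Σ₂-cong (λ j → cong (_∧ f j) (≟-sym j i))) (Σ₂-δ i f)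

↑-elim : ∀ m {P : Fin (m + n) → Set} →
         (∀ i → P (i ↑ˡ n)) → (∀ j → P (m ↑ʳ j)) → ∀ i → P i
↑-elim zero    left right i       = right i
↑-elim (suc m) left right zero    = left zero
↑-elim (suc m) left right (suc i) = ↑-elim m (left ∘ suc) right i

-- Vectors and matrices over Z₂

𝟎 : Vec₂ n
𝟎 _ = false

infixl 30 _⊕_

_⊕_ : Vec₂ n → Vec₂ n → Vec₂ n
(x ⊕ y) i = x i xor y i

⊕-congˡ : (x : Vec₂ n) {y z : Vec₂ n} → y ≐ z → x ⊕ y ≐ x ⊕ z
⊕-congˡ x h i = cong (x i xor_) (h i)

⊕-congʳ : (x : Vec₂ n) {y z : Vec₂ n} → y ≐ z → y ⊕ x ≐ z ⊕ x
⊕-congʳ x h i = cong (_xor x i) (h i)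

⊕-identityʳ : (x : Vec₂ n) → x ⊕ 𝟎 ≐ x
⊕-identityʳ x i = xor-identityʳ (x i)

⊕-self : (x : Vec₂ n) → x ⊕ x ≐ 𝟎
⊕-self x i = xor-same (x i)

⊕-cancelʳ : (x y : Vec₂ n) → x ⊕ y ⊕ y ≐ x
⊕-cancelʳ x y i = xor-cancelʳ (x i) (y i)

∪≐⊕ : {A B : Vec₂ n} → Disjoint A B → (A ∪ B) ≐ A ⊕ B
∪≐⊕ {A = A} {B} disjoint i = ∨≡xor (A i) (B i) (disjoint i)

•-congʳ : (x : Vec₂ n) {y z : Vec₂ n} → y ≐ z → x • y ≡ x • z
•-congʳ x h = Σ₂-cong (λ i → cong (x i ∧_) (h i))

•-comm : (x y : Vec₂ n) → x • y ≡ y • x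
•-comm x y = Σ₂-cong (λ i → ∧-comm (x i) (y i))

•-⊕ʳ : (x y z : Vec₂ n) → x • (y ⊕ z) ≡ x • y xor x • z
•-⊕ʳ x y z =
  trans (Σ₂-cong (λ i → ∧-distribˡ-xor (x i) (y i) (z i))) (Σ₂-xor (λ i → x i ∧ y i) (λ i → x i ∧ z i))

•-𝟎ʳ : (x : Vec₂ n) → x • 𝟎 ≡ false
•-𝟎ʳ {n} x = trans (Σ₂-cong (λ i → ∧-zeroʳ (x i))) (Σ₂-zero {n})

•-lincomb : (x : Vec₂ n) (v : Fin m → Vec₂ n) (κ : Fin m → Bool) →
            x • lincomb v κ ≡ Σ₂ (λ j → κ j ∧ (x • v j))
•-lincomb x v κ = begin
  Σ₂ (λ t → x t ∧ Σ₂ (λ j → κ j ∧ v j t))       ≡⟨ Σ₂-cong (λ t → ∧-distribˡ-Σ₂ (x t) (λ j → κ j ∧ v j t)) ⟩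
  Σ₂ (λ t → Σ₂ (λ j → x t ∧ (κ j ∧ v j t)))     ≡⟨ Σ₂-comm (λ t j → x t ∧ (κ j ∧ v j t)) ⟩
  Σ₂ (λ j → Σ₂ (λ t → x t ∧ (κ j ∧ v j t)))     ≡⟨ Σ₂-cong (λ j → Σ₂-cong (λ t → ∧-left-comm (x t) (κ j) (v j t))) ⟩
  Σ₂ (λ j → Σ₂ (λ t → κ j ∧ (x t ∧ v j t)))     ≡⟨ Σ₂-cong (λ j → ∧-distribˡ-Σ₂ (κ j) (λ t → x t ∧ v j t)) ⟨
  Σ₂ (λ j → κ j ∧ (x • v j))                    ∎
  where open ≡-Reasoning

lincomb-congˡ : (v : Fin m → Vec₂ n) {κ μ : Fin m → Bool} → κ ≐ μ → lincomb v κ ≐ lincomb v μ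
lincomb-congˡ v h t = Σ₂-cong (λ j → cong (_∧ v j t) (h j))

lincomb-congʳ : {v w : Fin m → Vec₂ n} (κ : Fin m → Bool) →
                (∀ j → v j ≐ w j) → lincomb v κ ≐ lincomb w κ
lincomb-congʳ κ h t = Σ₂-cong (λ j → cong (κ j ∧_) (h j t))

lincomb-𝟎 : (v : Fin m → Vec₂ n) → lincomb v 𝟎 ≐ 𝟎
lincomb-𝟎 {m} v t = Σ₂-zero {m}

lincomb-++ : ∀ {k} (v : Fin k → Vec₂ n) (w : Fin m → Vec₂ n) (κ : Fin (k + m) → Bool) →
             lincomb (v ++ w) κ ≐ lincomb v (κ ∘ (_↑ˡ m)) ⊕ lincomb w (κ ∘ (k ↑ʳ_))
lincomb-++ {k = k} v w κ t =
  trans (Σ₂-split k (λ i → κ i ∧ (v ++ w) i t))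
        (cong₂ _xor_ (Σ₂-cong (λ i → cong (λ u → κ (i ↑ˡ _) ∧ u t) (lookup-++ˡ v w i)))
                     (Σ₂-cong (λ j → cong (λ u → κ (k ↑ʳ j) ∧ u t) (lookup-++ʳ v w j))))

IsSymmetric : Mat₂ n → Set
IsSymmetric M = ∀ i j → M i j ≡ M j i

HasUnitDiagonal : Mat₂ n → Set
HasUnitDiagonal M = ∀ i → M i i ≡ true

·ᵥ-cong : (M : Mat₂ n) {x y : Vec₂ n} → x ≐ y → (M ·ᵥ x) ≐ (M ·ᵥ y)
·ᵥ-cong M h i = •-congʳ (M i) h

·ᵥ-⊕ : (M : Mat₂ n) (x y : Vec₂ n) → (M ·ᵥ (x ⊕ y)) ≐ (M ·ᵥ x) ⊕ (M ·ᵥ y)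
·ᵥ-⊕ M x y i = •-⊕ʳ (M i) x y

·ᵥ-𝟎 : (M : Mat₂ n) → (M ·ᵥ 𝟎) ≐ 𝟎
·ᵥ-𝟎 M i = •-𝟎ʳ (M i)

·ᵥ-lincomb : (M : Mat₂ n) (v : Fin m → Vec₂ n) (κ : Fin m → Bool) →
             (M ·ᵥ lincomb v κ) ≐ lincomb (λ j → M ·ᵥ v j) κ
·ᵥ-lincomb M v κ i = •-lincomb (M i) v κ

·ᵥ-sym-lincomb : (M : Mat₂ n) → IsSymmetric M → (x : Vec₂ n) → (M ·ᵥ x) ≐ lincomb M x
·ᵥ-sym-lincomb M M-sym x i =
  Σ₂-cong (λ j → trans (∧-comm (M i j) (x j)) (cong (x j ∧_) (M-sym i j)))

•-·ᵥ : (M : Mat₂ n) → IsSymmetric M → (x y : Vec₂ n) → x • (M ·ᵥ y) ≡ (M ·ᵥ x) • y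
•-·ᵥ M M-sym x y = begin
  x • (M ·ᵥ y)                  ≡⟨ •-congʳ x (·ᵥ-sym-lincomb M M-sym y) ⟩
  x • lincomb M y               ≡⟨ •-lincomb x M y ⟩
  Σ₂ (λ j → y j ∧ (x • M j))    ≡⟨ Σ₂-cong (λ j → cong (y j ∧_) (•-comm x (M j))) ⟩
  y • (M ·ᵥ x)                  ≡⟨ •-comm y (M ·ᵥ x) ⟩
  (M ·ᵥ x) • y                  ∎
  where open ≡-Reasoning

solves-• : (M : Mat₂ n) → IsSymmetric M → {u v c d : Vec₂ n} →
           Solves M u c → Solves M v d → c • v ≡ u • d
solves-• M M-sym {u} {v} hu hv = begin
  _              ≡⟨ Σ₂-cong (λ i → cong (_∧ v i) (hu i)) ⟨
  (M ·ᵥ u) • v   ≡⟨ •-·ᵥ M M-sym u v ⟨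
  u • (M ·ᵥ v)   ≡⟨ •-congʳ u hv ⟩
  _              ∎
  where open ≡-Reasoning

•-·ᵥ-self : (M : Mat₂ n) → IsSymmetric M → HasUnitDiagonal M → (x : Vec₂ n) →
            x • (M ·ᵥ x) ≡ x • 𝟏
•-·ᵥ-self M M-sym M-diag x = begin
  Σ₂ (λ i → x i ∧ Σ₂ (λ j → M i j ∧ x j))     ≡⟨ Σ₂-cong (λ i → ∧-distribˡ-Σ₂ (x i) (λ j → M i j ∧ x j)) ⟩
  Σ₂ (λ i → Σ₂ (λ j → x i ∧ (M i j ∧ x j)))   ≡⟨ Σ₂-diagonal _ summand-sym ⟩
  Σ₂ (λ i → x i ∧ (M i i ∧ x i))              ≡⟨ Σ₂-cong (λ i → cong (λ b → x i ∧ (b ∧ x i)) (M-diag i)) ⟩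
  Σ₂ (λ i → x i ∧ x i)                        ≡⟨ Σ₂-cong (λ i → trans (∧-idem (x i)) (sym (∧-identityʳ (x i)))) ⟩
  x • 𝟏                                       ∎
  where
    open ≡-Reasoning
    summand-sym : ∀ i j → x i ∧ (M i j ∧ x j) ≡ x j ∧ (M j i ∧ x i)
    summand-sym i j = begin
      x i ∧ (M i j ∧ x j)   ≡⟨ cong (λ b → x i ∧ (b ∧ x j)) (M-sym i j) ⟩
      x i ∧ (M j i ∧ x j)   ≡⟨ ∧-left-comm (x i) (M j i) (x j) ⟩
      M j i ∧ (x i ∧ x j)   ≡⟨ cong (M j i ∧_) (∧-comm (x i) (x j)) ⟩
      M j i ∧ (x j ∧ x i)   ≡⟨ ∧-left-comm (M j i) (x j) (x i) ⟩
      x j ∧ (M j i ∧ x i)   ∎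

·ᵥ-congᴹ : {M M′ : Mat₂ n} → (∀ i j → M i j ≡ M′ i j) → (p : Vec₂ n) → (M ·ᵥ p) ≐ (M′ ·ᵥ p)
·ᵥ-congᴹ h p i = Σ₂-cong (λ j → cong (_∧ p j) (h i j))

·ᵥ-update : (M : Mat₂ n) (x y : Fin m → Vec₂ n) (p : Vec₂ n) →
            ((λ i j → M i j xor Σ₂ (λ k → x k i ∧ y k j)) ·ᵥ p)
              ≐ (M ·ᵥ p) ⊕ lincomb x (λ k → y k • p)
·ᵥ-update M x y p i = begin
  Σ₂ (λ j → (M i j xor Σ₂ (λ k → x k i ∧ y k j)) ∧ p j)
    ≡⟨ Σ₂-cong (λ j → ∧-distribʳ-xor (p j) (M i j) _) ⟩
  Σ₂ (λ j → M i j ∧ p j xor Σ₂ (λ k → x k i ∧ y k j) ∧ p j)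
    ≡⟨ Σ₂-xor (λ j → M i j ∧ p j) (λ j → Σ₂ (λ k → x k i ∧ y k j) ∧ p j) ⟩
  (M ·ᵥ p) i xor Σ₂ (λ j → Σ₂ (λ k → x k i ∧ y k j) ∧ p j)
    ≡⟨ cong ((M ·ᵥ p) i xor_) update ⟩
  (M ·ᵥ p) i xor lincomb x (λ k → y k • p) i
    ∎
  where
    open ≡-Reasoning
    update : Σ₂ (λ j → Σ₂ (λ k → x k i ∧ y k j) ∧ p j) ≡ Σ₂ (λ k → (y k • p) ∧ x k i)
    update = begin
      Σ₂ (λ j → Σ₂ (λ k → x k i ∧ y k j) ∧ p j)
        ≡⟨ Σ₂-cong (λ j → trans (∧-comm _ (p j)) (∧-distribˡ-Σ₂ (p j) (λ k → x k i ∧ y k j))) ⟩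
      Σ₂ (λ j → Σ₂ (λ k → p j ∧ (x k i ∧ y k j)))
        ≡⟨ Σ₂-comm (λ j k → p j ∧ (x k i ∧ y k j)) ⟩
      Σ₂ (λ k → Σ₂ (λ j → p j ∧ (x k i ∧ y k j)))
        ≡⟨ Σ₂-cong (λ k → Σ₂-cong (λ j →
             trans (∧-left-comm (p j) (x k i) (y k j)) (cong (x k i ∧_) (∧-comm (p j) (y k j))))) ⟩
      Σ₂ (λ k → Σ₂ (λ j → x k i ∧ (y k j ∧ p j)))
        ≡⟨ Σ₂-cong (λ k → trans (sym (∧-distribˡ-Σ₂ (x k i) (λ j → y k j ∧ p j))) (∧-comm (x k i) _)) ⟩
      Σ₂ (λ k → (y k • p) ∧ x k i)
        ∎

lincomb-ker : (M : Mat₂ n) (v : Fin m → Vec₂ n) (κ : Fin m → Bool) →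
              (∀ j → Solves M (v j) 𝟎) → Solves M (lincomb v κ) 𝟎
lincomb-ker {m = m} M v κ v-ker i =
  trans (·ᵥ-lincomb M v κ i)
        (trans (Σ₂-cong (λ j → trans (cong (κ j ∧_) (v-ker j i)) (∧-zeroʳ (κ j)))) (Σ₂-zero {m}))

-- Projections along the span of a family with a dual family

module Projection {m n : ℕ} (A dual : Fin m → Vec₂ n)
                  (biorthogonal : ∀ i j → dual i • A j ≡ ⌊ i ≟ j ⌋) where

  coords : Vec₂ n → Vec₂ m
  coords c i = dual i • c

  project : Vec₂ n → Vec₂ n
  project c = c ⊕ lincomb A (coords c)

  coords-cong : {c d : Vec₂ n} → c ≐ d → coords c ≐ coords d
  coords-cong h i = •-congʳ (dual i) h

  coords-⊕ : (c d : Vec₂ n) → coords (c ⊕ d) ≐ coords c ⊕ coords d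
  coords-⊕ c d i = •-⊕ʳ (dual i) c d

  coords-𝟎 : coords 𝟎 ≐ 𝟎
  coords-𝟎 i = •-𝟎ʳ (dual i)

  coords-lincomb : (κ : Vec₂ m) → coords (lincomb A κ) ≐ κ
  coords-lincomb κ i = begin
    dual i • lincomb A κ               ≡⟨ •-lincomb (dual i) A κ ⟩
    Σ₂ (λ j → κ j ∧ (dual i • A j))    ≡⟨ Σ₂-cong (λ j → cong (κ j ∧_) (biorthogonal i j)) ⟩
    Σ₂ (λ j → κ j ∧ ⌊ i ≟ j ⌋)         ≡⟨ Σ₂-cong (λ j → ∧-comm (κ j) ⌊ i ≟ j ⌋) ⟩
    Σ₂ (λ j → ⌊ i ≟ j ⌋ ∧ κ j)         ≡⟨ Σ₂-δ i κ ⟩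
    κ i                                ∎
    where open ≡-Reasoning

  lincomb-coords-basis : (j : Fin m) → lincomb A (coords (A j)) ≐ A j
  lincomb-coords-basis j t =
    trans (Σ₂-cong (λ i → cong (_∧ A i t) (biorthogonal i j))) (Σ₂-δ′ j (λ i → A i t))

  coords-project : (c : Vec₂ n) → coords (project c) ≐ 𝟎
  coords-project c = begin
    coords (c ⊕ lincomb A (coords c))               ≈⟨ coords-⊕ c _ ⟩
    coords c ⊕ coords (lincomb A (coords c))        ≈⟨ ⊕-congˡ (coords c) (coords-lincomb (coords c)) ⟩
    coords c ⊕ coords c                             ≈⟨ ⊕-self (coords c) ⟩
    𝟎                                               ∎
    where open ≐-Reasoning

  project-≐ : {c : Vec₂ n} {κ : Vec₂ m} → coords c ≐ κ → project c ≐ c ⊕ lincomb A κ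
  project-≐ {c} h = ⊕-congˡ c (lincomb-congˡ A h)

  module Perturbation (M M* : Mat₂ n) (r : Fin m → Vec₂ n)
                      (r-solves : ∀ j → Solves M (r j) (A j))
                      (M*≐project : ∀ p → (M* ·ᵥ p) ≐ project (M ·ᵥ p)) where

    M*-solves : {p c : Vec₂ n} {κ : Vec₂ m} →
                Solves M p c → coords c ≐ κ → Solves M* p (c ⊕ lincomb A κ)
    M*-solves {p} {c} {κ} hp hc = begin
      M* ·ᵥ p                      ≈⟨ M*≐project p ⟩
      project (M ·ᵥ p)             ≈⟨ project-≐ (λ i → trans (coords-cong hp i) (hc i)) ⟩
      (M ·ᵥ p) ⊕ lincomb A κ       ≈⟨ ⊕-congʳ (lincomb A κ) hp ⟩
      c ⊕ lincomb A κ              ∎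
      where open ≐-Reasoning

    M*-solves⁻¹ : {p d : Vec₂ n} → Solves M* p d →
                  Solves M p (d ⊕ lincomb A (coords (M ·ᵥ p)))
    M*-solves⁻¹ {p} {d} hp = begin
      M ·ᵥ p                                   ≈⟨ ⊕-cancelʳ (M ·ᵥ p) _ ⟨
      project (M ·ᵥ p) ⊕ lincomb A (coords (M ·ᵥ p))
                                               ≈⟨ ⊕-congʳ _ (λ t → trans (sym (M*≐project p t)) (hp t)) ⟩
      d ⊕ lincomb A (coords (M ·ᵥ p))          ∎
      where open ≐-Reasoning

    M*-coords : {p d : Vec₂ n} → Solves M* p d → coords d ≐ 𝟎
    M*-coords {p} {d} hp = begin
      coords d                 ≈⟨ coords-cong (λ t → trans (sym (hp t)) (M*≐project p t)) ⟩
      coords (project (M ·ᵥ p)) ≈⟨ coords-project (M ·ᵥ p) ⟩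
      𝟎                        ∎
      where open ≐-Reasoning

    solves-𝟏 : coords 𝟏 ≐ 𝟎 → (p : Vec₂ n) →
               Solves M* p 𝟏 ⇔ ∃ λ κ → Solves M p (𝟏 ⊕ lincomb A κ)
    solves-𝟏 coords-𝟏 p = mk⇔ (λ hp → coords (M ·ᵥ p) , M*-solves⁻¹ hp) from
      where
        from : ∃ (λ κ → Solves M p (𝟏 ⊕ lincomb A κ)) → Solves M* p 𝟏
        from (κ , hp) t = trans (M*-solves hp coords-target t) (⊕-cancelʳ 𝟏 (lincomb A κ) t)
          where
            coords-target : coords (𝟏 ⊕ lincomb A κ) ≐ κ
            coords-target i =
              trans (coords-⊕ 𝟏 (lincomb A κ) i)
                    (cong₂ _xor_ (coords-𝟏 i) (coords-lincomb κ i))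

    basis-unsolvable : (j : Fin m) → HO M* (A j)
    basis-unsolvable j (p , hp)
      with trans (sym (≟-refl j)) (trans (sym (biorthogonal j j)) (M*-coords hp j))
    ... | ()

    lincomb-r-solves : (κ : Vec₂ m) → Solves M (lincomb r κ) (lincomb A κ)
    lincomb-r-solves κ i = trans (·ᵥ-lincomb M r κ i) (lincomb-congʳ κ r-solves i)

    ker-M*-r : ∀ j → Solves M* (r j) 𝟎
    ker-M*-r j t =
      trans (M*-solves (r-solves j) (λ _ → refl) t)
            (trans (⊕-congˡ (A j) (lincomb-coords-basis j) t) (⊕-self (A j) t))

    ker-M*-++ : ∀ {k} {b : Fin k → Vec₂ n} → (∀ j → Solves M (b j) 𝟎) →
                ∀ i → Solves M* ((b ++ r) i) 𝟎
    ker-M*-++ {k} {b} b-ker i =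
      [_,_] {C = λ s → Solves M* ([ b , r ]′ s) 𝟎} ker-M*-b ker-M*-r (splitAt k i)
      where
        ker-M*-b : ∀ j → Solves M* (b j) 𝟎
        ker-M*-b j t = trans (M*-solves (b-ker j) coords-𝟎 t) (lincomb-𝟎 A t)

    ++-independent : ∀ {k} {b : Fin k → Vec₂ n} → (∀ j → Solves M (b j) 𝟎) →
                     (∀ c → lincomb b c ≐ 𝟎 → c ≐ 𝟎) →
                     ∀ c → lincomb (b ++ r) c ≐ 𝟎 → c ≐ 𝟎
    ++-independent {k} {b} b-ker b-independent c h = ↑-elim k cˡ≐𝟎 cʳ≐𝟎
      where
        open ≐-Reasoning
        cˡ = c ∘ (_↑ˡ m)
        cʳ = c ∘ (k ↑ʳ_)

        split : lincomb b cˡ ⊕ lincomb r cʳ ≐ 𝟎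
        split t = trans (sym (lincomb-++ b r c t)) (h t)

        lincomb-A≐𝟎 : lincomb A cʳ ≐ 𝟎
        lincomb-A≐𝟎 = begin
          lincomb A cʳ
            ≈⟨ ⊕-congʳ (lincomb A cʳ) (lincomb-ker M b cˡ b-ker) ⟨
          (M ·ᵥ lincomb b cˡ) ⊕ lincomb A cʳ
            ≈⟨ ⊕-congˡ (M ·ᵥ lincomb b cˡ) (lincomb-r-solves cʳ) ⟨
          (M ·ᵥ lincomb b cˡ) ⊕ (M ·ᵥ lincomb r cʳ)   ≈⟨ ·ᵥ-⊕ M (lincomb b cˡ) (lincomb r cʳ) ⟨
          M ·ᵥ (lincomb b cˡ ⊕ lincomb r cʳ)          ≈⟨ ·ᵥ-cong M split ⟩
          M ·ᵥ 𝟎                                      ≈⟨ ·ᵥ-𝟎 M ⟩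
          𝟎                                           ∎

        cʳ≐𝟎 : cʳ ≐ 𝟎
        cʳ≐𝟎 = begin
          cʳ                      ≈⟨ coords-lincomb cʳ ⟨
          coords (lincomb A cʳ)   ≈⟨ coords-cong lincomb-A≐𝟎 ⟩
          coords 𝟎                ≈⟨ coords-𝟎 ⟩
          𝟎                       ∎

        cˡ≐𝟎 : cˡ ≐ 𝟎
        cˡ≐𝟎 = b-independent cˡ (begin
          lincomb b cˡ                    ≈⟨ ⊕-identityʳ (lincomb b cˡ) ⟨
          lincomb b cˡ ⊕ 𝟎                ≈⟨ ⊕-congˡ (lincomb b cˡ) (lincomb-𝟎 r) ⟨
          lincomb b cˡ ⊕ lincomb r 𝟎      ≈⟨ ⊕-congˡ (lincomb b cˡ) (lincomb-congˡ r cʳ≐𝟎) ⟨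
          lincomb b cˡ ⊕ lincomb r cʳ     ≈⟨ split ⟩
          𝟎                               ∎)

    ++-spanning : ∀ {k} {b : Fin k → Vec₂ n} →
                  (∀ v → Solves M v 𝟎 → ∃ λ c → v ≐ lincomb b c) →
                  ∀ v → Solves M* v 𝟎 → ∃ λ c → v ≐ lincomb (b ++ r) c
    ++-spanning {k} {b} b-spanning v hv = d ++ κ , (begin
      v                                    ≈⟨ ⊕-cancelʳ v (lincomb r κ) ⟨
      v ⊕ lincomb r κ ⊕ lincomb r κ        ≈⟨ ⊕-congʳ (lincomb r κ) v+rκ≐bd ⟩
      lincomb b d ⊕ lincomb r κ            ≈⟨ ⊕-congʳ (lincomb r κ) (lincomb-congˡ b (lookup-++ˡ d κ)) ⟨
      lincomb b ((d ++ κ) ∘ (_↑ˡ m)) ⊕ lincomb r κ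
        ≈⟨ ⊕-congˡ (lincomb b ((d ++ κ) ∘ (_↑ˡ m))) (lincomb-congˡ r (lookup-++ʳ d κ)) ⟨
      lincomb b ((d ++ κ) ∘ (_↑ˡ m)) ⊕ lincomb r ((d ++ κ) ∘ (k ↑ʳ_))
        ≈⟨ lincomb-++ b r (d ++ κ) ⟨
      lincomb (b ++ r) (d ++ κ)            ∎)
      where
        open ≐-Reasoning
        κ = coords (M ·ᵥ v)

        v+rκ-ker : Solves M (v ⊕ lincomb r κ) 𝟎
        v+rκ-ker = begin
          M ·ᵥ (v ⊕ lincomb r κ)                ≈⟨ ·ᵥ-⊕ M v (lincomb r κ) ⟩
          (M ·ᵥ v) ⊕ (M ·ᵥ lincomb r κ)          ≈⟨ ⊕-congʳ (M ·ᵥ lincomb r κ) (M*-solves⁻¹ hv) ⟩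
          lincomb A κ ⊕ (M ·ᵥ lincomb r κ)       ≈⟨ ⊕-congˡ (lincomb A κ) (lincomb-r-solves κ) ⟩
          lincomb A κ ⊕ lincomb A κ              ≈⟨ ⊕-self (lincomb A κ) ⟩
          𝟎                                      ∎

        d = proj₁ (b-spanning (v ⊕ lincomb r κ) v+rκ-ker)
        v+rκ≐bd = proj₂ (b-spanning (v ⊕ lincomb r κ) v+rκ-ker)

    nullity : ∀ {k} → HasNullity M k → HasNullity M* (k + m)
    nullity (b , b-ker , b-independent , b-spanning) =
      b ++ r , ker-M*-++ b-ker , ++-independent b-ker b-independent , ++-spanning b-spanning

-- Closed neighbourhood matrices

closedNbhd-sym : (G : SimpleGraph n) → IsSymmetric (N G)
closedNbhd-sym G i j = cong₂ _∨_ (≟-sym i j) (SimpleGraph.sym G i j)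

closedNbhd-diagonal : (G : SimpleGraph n) → HasUnitDiagonal (N G)
closedNbhd-diagonal G i = cong (_∨ adj G i i) (≟-refl i)

closedNbhd-xor : (a t : Fin n → Fin n → Bool) → (∀ i → t i i ≡ false) → ∀ i j →
                 closedNbhd (λ i j → a i j xor t i j) i j ≡ closedNbhd a i j xor t i j
closedNbhd-xor a t t-diag i j with i ≟ j
... | yes refl = sym (cong (true xor_) (t-diag i))
... | no _     = refl

module _ (G : SimpleGraph n) {A₁ A₂ : Vec₂ n} (disjoint : Disjoint A₁ A₂) where

  toggled : Fin n → Fin n → Bool
  toggled i j = (A₁ i ∧ A₂ j) ∨ (A₁ j ∧ A₂ i)

  toggled-diagonal : ∀ i → toggled i i ≡ false
  toggled-diagonal i = cong₂ _∨_ (disjoint i) (disjoint i)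

  toggled≡outer : ∀ i j →
                  toggled i j ≡ Σ₂ (λ k → (A₁ ∷ A₂ ∷ []) k i ∧ (A₂ ∷ A₁ ∷ []) k j)
  toggled≡outer i j = begin
    (A₁ i ∧ A₂ j) ∨ (A₁ j ∧ A₂ i)             ≡⟨ cong ((A₁ i ∧ A₂ j) ∨_) (∧-comm (A₁ j) (A₂ i)) ⟩
    (A₁ i ∧ A₂ j) ∨ (A₂ i ∧ A₁ j)             ≡⟨ ∨≡xor (A₁ i ∧ A₂ j) (A₂ i ∧ A₁ j)
                                                   (∧-∧-zero (A₁ i) (A₂ i) (A₂ j) (A₁ j) (disjoint i)) ⟩
    (A₁ i ∧ A₂ j) xor (A₂ i ∧ A₁ j)           ≡⟨ cong ((A₁ i ∧ A₂ j) xor_) (xor-identityʳ _) ⟨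
    (A₁ i ∧ A₂ j) xor (A₂ i ∧ A₁ j) xor false ∎
    where open ≡-Reasoning

  N*-·ᵥ : (p : Vec₂ n) →
          (N* G A₁ A₂ ·ᵥ p) ≐ (N G ·ᵥ p) ⊕ lincomb (A₁ ∷ A₂ ∷ []) (λ k → (A₂ ∷ A₁ ∷ []) k • p)
  N*-·ᵥ p i =
    trans (·ᵥ-congᴹ entries p i) (·ᵥ-update (N G) (A₁ ∷ A₂ ∷ []) (A₂ ∷ A₁ ∷ []) p i)
    where
      entries : ∀ i j →
                N* G A₁ A₂ i j ≡ N G i j xor Σ₂ (λ k → (A₁ ∷ A₂ ∷ []) k i ∧ (A₂ ∷ A₁ ∷ []) k j)
      entries i j = trans (closedNbhd-xor (adj G) toggled toggled-diagonal i j)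
                          (cong (N G i j xor_) (toggled≡outer i j))

module _ {A₁ A₂ : Vec₂ n} (disjoint : Disjoint A₁ A₂) where

  configurations : (v : Vec₂ n) →
                   (∃ λ κ → v ≐ 𝟏 ⊕ lincomb (A₁ ∷ A₂ ∷ []) κ)
                     ⇔ (v ≐ 𝟏 ⊎ v ≐ ‾ A₁ ⊎ v ≐ ‾ A₂ ⊎ v ≐ ‾ (A₁ ∪ A₂))
  configurations v = mk⇔ (λ (κ , h) → to (κ zero) (κ (suc zero)) h) from
    where
      ‾A₁∪A₂ : ∀ t → not (A₁ t xor A₂ t xor false) ≡ not ((A₁ ∪ A₂) t)
      ‾A₁∪A₂ t =
        cong not (trans (cong (A₁ t xor_) (xor-identityʳ (A₂ t))) (sym (∪≐⊕ {A = A₁} {A₂} disjoint t)))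

      to : ∀ a b → v ≐ 𝟏 ⊕ lincomb (A₁ ∷ A₂ ∷ []) (a ∷ b ∷ []) →
           v ≐ 𝟏 ⊎ v ≐ ‾ A₁ ⊎ v ≐ ‾ A₂ ⊎ v ≐ ‾ (A₁ ∪ A₂)
      to false false h = inj₁ h
      to true  false h = inj₂ (inj₁ (λ t → trans (h t) (cong not (xor-identityʳ (A₁ t)))))
      to false true  h = inj₂ (inj₂ (inj₁ (λ t → trans (h t) (cong not (xor-identityʳ (A₂ t))))))
      to true  true  h = inj₂ (inj₂ (inj₂ (λ t → trans (h t) (‾A₁∪A₂ t))))

      from : v ≐ 𝟏 ⊎ v ≐ ‾ A₁ ⊎ v ≐ ‾ A₂ ⊎ v ≐ ‾ (A₁ ∪ A₂) →
             ∃ λ κ → v ≐ 𝟏 ⊕ lincomb (A₁ ∷ A₂ ∷ []) κ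
      from (inj₁ h) = (false ∷ false ∷ []) , h
      from (inj₂ (inj₁ h)) =
        (true ∷ false ∷ []) , λ t → trans (h t) (cong not (sym (xor-identityʳ (A₁ t))))
      from (inj₂ (inj₂ (inj₁ h))) =
        (false ∷ true ∷ []) , λ t → trans (h t) (cong not (sym (xor-identityʳ (A₂ t))))
      from (inj₂ (inj₂ (inj₂ h))) =
        (true ∷ true ∷ []) , λ t → trans (h t) (sym (‾A₁∪A₂ t))

module _ (M : Mat₂ n) (M-sym : IsSymmetric M) where

  NO-•𝟏 : {A r : Vec₂ n} → Solves M r A → NO M A → r • 𝟏 ≡ false
  NO-•𝟏 hr (_ , (p , hp) , A•solution) = trans (sym (solves-• M M-sym hr hp)) (A•solution p hp)

  NO-•self : HasUnitDiagonal M → {A r : Vec₂ n} → Solves M r A → NO M A → r • A ≡ false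
  NO-•self M-diag {A} {r} hr A-NO = begin
    r • A          ≡⟨ •-congʳ r hr ⟨
    r • (M ·ᵥ r)   ≡⟨ •-·ᵥ-self M M-sym M-diag r ⟩
    r • 𝟏          ≡⟨ NO-•𝟏 hr A-NO ⟩
    false          ∎
    where open ≡-Reasoning

  AO-• : {A₁ A₂ r₂ : Vec₂ n} → Solves M r₂ A₂ → NO M A₂ → AO[ ‾ A₁ ] M A₂ → r₂ • A₁ ≡ true
  AO-• {A₁} {A₂} {r₂} hr₂ A₂-NO (_ , (q , hq) , A₂•q) = begin
    r₂ • A₁                  ≡⟨ cong (_xor (r₂ • A₁)) (NO-•𝟏 hr₂ A₂-NO) ⟨
    r₂ • 𝟏 xor r₂ • A₁       ≡⟨ •-⊕ʳ r₂ 𝟏 A₁ ⟨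
    r₂ • ‾ A₁                ≡⟨ solves-• M M-sym hr₂ hq ⟨
    A₂ • q                   ≡⟨ A₂•q q hq ⟩
    true                     ∎
    where open ≡-Reasoning

module Toggle (G : SimpleGraph n) (A₁ A₂ : Vec₂ n) (disjoint : Disjoint A₁ A₂)
              (no₁ : NO (N G) A₁) (no₂ : NO (N G) A₂) (ao : AO[ ‾ A₁ ] (N G) A₂) where

  N-sym : IsSymmetric (N G)
  N-sym = closedNbhd-sym G

  r₁ r₂ : Vec₂ n
  r₁ = proj₁ (proj₁ no₁)
  r₂ = proj₁ (proj₁ no₂)

  r₁-solves : Solves (N G) r₁ A₁
  r₁-solves = proj₂ (proj₁ no₁)

  r₂-solves : Solves (N G) r₂ A₂
  r₂-solves = proj₂ (proj₁ no₂)

  sets pre-images dual : Fin 2 → Vec₂ n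
  sets      = A₁ ∷ A₂ ∷ []
  pre-images = r₁ ∷ r₂ ∷ []
  dual      = r₂ ∷ r₁ ∷ []

  pre-images-solve : ∀ k → Solves (N G) (pre-images k) (sets k)
  pre-images-solve zero       = r₁-solves
  pre-images-solve (suc zero) = r₂-solves

  r₂•A₁ : r₂ • A₁ ≡ true
  r₂•A₁ = AO-• (N G) N-sym r₂-solves no₂ ao

  biorthogonal : ∀ i j → dual i • sets j ≡ ⌊ i ≟ j ⌋
  biorthogonal zero       zero       = r₂•A₁
  biorthogonal zero       (suc zero) = NO-•self (N G) N-sym (closedNbhd-diagonal G) r₂-solves no₂
  biorthogonal (suc zero) zero       = NO-•self (N G) N-sym (closedNbhd-diagonal G) r₁-solves no₁
  biorthogonal (suc zero) (suc zero) =
    trans (sym (solves-• (N G) N-sym r₁-solves r₂-solves)) (trans (•-comm A₁ r₂) r₂•A₁)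

  open Projection sets dual biorthogonal public

  coords-𝟏 : coords 𝟏 ≐ 𝟎
  coords-𝟏 zero       = NO-•𝟏 (N G) N-sym r₂-solves no₂
  coords-𝟏 (suc zero) = NO-•𝟏 (N G) N-sym r₁-solves no₁

  N*≐project : ∀ p → (N* G A₁ A₂ ·ᵥ p) ≐ project (N G ·ᵥ p)
  N*≐project p t =
    trans (N*-·ᵥ G disjoint p t) (⊕-congˡ (N G ·ᵥ p) (lincomb-congˡ sets coefficient) t)
    where
      coefficient : ∀ k → (A₂ ∷ A₁ ∷ []) k • p ≡ coords (N G ·ᵥ p) k
      coefficient zero       = solves-• (N G) N-sym r₂-solves (λ _ → refl)
      coefficient (suc zero) = solves-• (N G) N-sym r₁-solves (λ _ → refl)

  open Perturbation (N G) (N* G A₁ A₂) pre-images pre-images-solve N*≐project public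

mainTheorem10 : {n : ℕ} (G : SimpleGraph n) (A₁ A₂ : Vec₂ n)
    → Disjoint A₁ A₂
    → NO (N G) A₁ → NO (N G) A₂
    → AO[ ‾ A₁ ] (N G) A₂
    → (∀ (p : Vec₂ n) → Solves (N* G A₁ A₂) p 𝟏
          ⇔ (Solves (N G) p 𝟏 ⊎ Solves (N G) p (‾ A₁)
              ⊎ Solves (N G) p (‾ A₂) ⊎ Solves (N G) p (‾ (A₁ ∪ A₂))))
      × HO (N* G A₁ A₂) A₁ × HO (N* G A₁ A₂) A₂
      × (∀ k → HasNullity (N G) k → HasNullity (N* G A₁ A₂) (k + 2))
mainTheorem10 G A₁ A₂ disjoint no₁ no₂ ao =
    (λ p → configurations disjoint (N G ·ᵥ p) ⇔-∘ solves-𝟏 coords-𝟏 p)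
  , basis-unsolvable zero
  , basis-unsolvable (suc zero)
  , λ k → nullity
  where open Toggle G A₁ A₂ disjoint no₁ no₂ ao
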